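{- A function $f:\mathbb{N}\to\mathbb{N}$ is Fibonacci-synchronised if and only if it is Chung-Graham-synchronised.
   Context: Fibonacci numbers: $F_0=0$, $F_1=1$, $F_{n+1}=F_n+F_{n-1}$ for $n\ge1$. For a word $a=a_0\cdots a_{m-1}$ over $\{0,1,2\}$ (least significant digit first), $\mathrm{val}(a)=\sum_i a_iF_{i+2}$. A Zeckendorf word is a word over $\{0,1\}$ with no two consecutive 1's; a Chung-Graham word is a word over $\{0,1,2\}$ with $a_i=0$ for odd $i$ and such that between any two even positions $i<j$ with $a_i=a_j=2$ there is an even $k$, $i<k<j$, with $a_k=0$. Every $n\ge0$ has a unique Zeckendorf (resp. Chung-Graham) representation up to trailing zeros. $f$ is Fibonacci-synchronised if there is a finite automaton that, reading pairs of equal-length Zeckendorf words $(u,v)$ in parallel (shorter representation padded with trailing zeros), accepts exactly when $f(\mathrm{val}(u))=\mathrm{val}(v)$; Chung-Graham-synchronised is defined the same way with Chung-Graham words in place of Zeckendorf words. -}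

module Defs where

open import Data.Nat using (ℕ; zero; suc; _+_; _*_; _<_)
open import Data.Fin using (Fin; toℕ)
open import Data.List using (List; []; _∷_; map; foldl)
open import Data.Bool using (Bool; true)
open import Data.Product using (_×_; proj₁; proj₂; ∃; Σ)
open import Data.Empty using (⊥)
open import Relation.Binary.PropositionalEquality using (_≡_)
open import Function.Bundles using (_⇔_)

fib : ℕ → ℕ
fib zero = 0
fib (suc zero) = 1
fib (suc (suc n)) = fib (suc n) + fib n

-- digit at position i (least significant first); 0 beyond the end
dig : ∀ {k} → List (Fin k) → ℕ → ℕ
dig [] i = 0
dig (d ∷ ds) zero = toℕ d
dig (d ∷ ds) (suc i) = dig ds i

valFrom : ∀ {k} → ℕ → List (Fin k) → ℕ
valFrom i [] = 0
valFrom i (d ∷ ds) = toℕ d * fib (i + 2) + valFrom (suc i) ds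

val : ∀ {k} → List (Fin k) → ℕ
val = valFrom 0

IsZeckendorf : List (Fin 2) → Set
IsZeckendorf w = ∀ i → dig w i ≡ 1 → dig w (suc i) ≡ 1 → ⊥

IsChungGraham : List (Fin 3) → Set
IsChungGraham w =
  (∀ m → dig w (2 * m + 1) ≡ 0) ×
  (∀ m n → m < n → dig w (2 * m) ≡ 2 → dig w (2 * n) ≡ 2 →
     ∃ λ p → m < p × p < n × dig w (2 * p) ≡ 0)

record DFA (A : Set) : Set where
  field
    nStates : ℕ
    start   : Fin nStates
    δ       : Fin nStates → A → Fin nStates
    accept  : Fin nStates → Bool

-- the automaton reads the word from its head (least significant digit first)
accepts : ∀ {A} → DFA A → List A → Bool
accepts M w = DFA.accept M (foldl (DFA.δ M) (DFA.start M) w)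

Synchronised : (k : ℕ) → (List (Fin k) → Set) → (ℕ → ℕ) → Set
Synchronised k Valid f =
  Σ (DFA (Fin k × Fin k)) λ M → ∀ (w : List (Fin k × Fin k)) →
    (accepts M w ≡ true) ⇔
    (Valid (map proj₁ w) × Valid (map proj₂ w) ×
     f (val (map proj₁ w)) ≡ val (map proj₂ w))

FibonacciSynchronised : (ℕ → ℕ) → Set
FibonacciSynchronised = Synchronised 2 IsZeckendorf

ChungGrahamSynchronised : (ℕ → ℕ) → Set
ChungGrahamSynchronised = Synchronised 3 IsChungGraham

-- Both notions are equivalent to the recognisability of the graph of f on arbitrary pairs of words
-- over {0,1,2} (Graph f below): restricting a graph automaton to valid words synchronises f.
-- Conversely, from a synchronising automaton M one builds a nondeterministic automaton that, reading
-- a pair (x , y), guesses valid representations (u , v) of the same values, runs M on them and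
-- checks val x = val u and val y = val v. Equality of values is finite-state: when two words have
-- equal values, the unread suffix of their difference has bounded coordinates in the basis
-- (F (k+2) , F (k+1)) at every position k. The guesses need three more digits than the input,
-- since a word of length ℓ over {0,1,2} has value below F (ℓ+5); hence the input is padded with
-- three zeros, and nondeterminism is removed by the subset construction.
module Submission where

open import Defs
open import Data.Nat using (ℕ; zero; suc)
open import Data.Fin using (Fin; toℕ; suc)
open import Data.Fin.Patterns using (0F; 1F; 2F)
open import Data.Fin.Properties using (*↔×)
open import Data.List using (List; []; _∷_; map; foldl; _++_; length; replicate; zip)
open import Data.List.Properties using (foldl-map; foldl-++; map-∘; map-++; length-++; length-map)
open import Data.Bool using (Bool; true; false; _∧_)
import Data.Bool.Properties as Bool
open import Data.Maybe using (Maybe; just; nothing)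
open import Data.Product using (Σ; ∃; ∃₂; _×_; _,_; proj₁; proj₂; <_,_>)
import Data.Product as Product
open import Data.Product.Function.NonDependent.Propositional using (_×-⇔_; _×-↔_)
open import Data.Sum using (_⊎_; inj₁; inj₂)
open import Data.Unit using (⊤; tt)
open import Data.Empty using (⊥; ⊥-elim)
open import Function using (_∘_; _∘′_; case_of_)
open import Function.Bundles using (_⇔_; mk⇔; _↔_; Inverse; Equivalence)
import Function.Properties.Equivalence as ⇔
open import Function.Properties.Inverse using (↔-refl; ↔-trans)
open import Relation.Binary.Definitions using (DecidableEquality)
open import Relation.Binary.PropositionalEquality
  using (_≡_; refl; sym; trans; cong; cong₂; subst; subst₂; module ≡-Reasoning)
open import Relation.Nullary using (Dec; yes; no; does; map′; _×-dec_)
open import Relation.Unary using (Decidable)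

module Automata where

  open import Data.Nat using (_*_; _^_)
  open import Data.Fin using (combine; remQuot; finToFun; funToFin)
  open import Data.Fin.Properties using (remQuot-combine; finToFun-funToFin; any?) renaming (_≟_ to _≟ᶠ_)
  import Data.Maybe.Properties as Maybe

  private
    variable
      A B G : Set

  Recognisable : (List A → Set) → Set
  Recognisable {A} L = Σ (DFA A) λ M → ∀ w → (accepts M w ≡ true) ⇔ L w

  recognisable-resp : {L L′ : List A → Set} → (∀ w → L w ⇔ L′ w) → Recognisable L → Recognisable L′
  recognisable-resp L⇔L′ (M , M-ok) = M , λ w → ⇔.trans (M-ok w) (L⇔L′ w)

  recognisable-preimage : {L : List B → Set} (h : A → B) → Recognisable L → Recognisable (L ∘ map h)
  recognisable-preimage {A = A} h (M , M-ok) =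
    M′ , λ w → subst (λ q → (accept q ≡ true) ⇔ _) (foldl-map δ h start w) (M-ok (map h w))
    where
    open DFA M
    M′ : DFA A
    M′ = record { nStates = nStates ; start = start ; δ = λ q a → δ q (h a) ; accept = accept }

  recognisable-quotient : {L : List A → Set} (s : List A) → Recognisable L → Recognisable (λ w → L (w ++ s))
  recognisable-quotient {A = A} s (M , M-ok) =
    M′ , λ w → subst (λ q → (accept q ≡ true) ⇔ _) (foldl-++ δ start w s) (M-ok (w ++ s))
    where
    open DFA M
    M′ : DFA A
    M′ = record { nStates = nStates ; start = start ; δ = δ ; accept = λ q → accept (foldl δ q s) }

  ∧≡true⇔ : ∀ {a b} → (a ∧ b ≡ true) ⇔ (a ≡ true × b ≡ true)
  ∧≡true⇔ {true}  = mk⇔ (λ b≡true → refl , b≡true) proj₂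
  ∧≡true⇔ {false} = mk⇔ (λ ()) (λ ())

  recognisable-∩ : {L₁ L₂ : List A → Set} →
    Recognisable L₁ → Recognisable L₂ → Recognisable (λ w → L₁ w × L₂ w)
  recognisable-∩ {A} {L₁} {L₂} (M₁ , M₁-ok) (M₂ , M₂-ok) = M , M-ok
    where
    module M₁ = DFA M₁
    module M₂ = DFA M₂
    pair : Fin (M₁.nStates * M₂.nStates) → Fin M₁.nStates × Fin M₂.nStates
    pair = remQuot M₂.nStates
    M : DFA A
    M = record
      { nStates = M₁.nStates * M₂.nStates
      ; start   = combine M₁.start M₂.start
      ; δ       = λ i a → combine (M₁.δ (proj₁ (pair i)) a) (M₂.δ (proj₂ (pair i)) a)
      ; accept  = λ i → M₁.accept (proj₁ (pair i)) ∧ M₂.accept (proj₂ (pair i))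
      }
    pair-combine : ∀ p q → pair (combine p q) ≡ (p , q)
    pair-combine = remQuot-combine
    run : ∀ p q w → foldl (DFA.δ M) (combine p q) w ≡ combine (foldl M₁.δ p w) (foldl M₂.δ q w)
    run p q []      = refl
    run p q (a ∷ w) = trans
      (cong (λ (p′ , q′) → foldl (DFA.δ M) (combine (M₁.δ p′ a) (M₂.δ q′ a)) w) (pair-combine p q))
      (run (M₁.δ p a) (M₂.δ q a) w)
    accepts-M : ∀ w → accepts M w ≡ (accepts M₁ w ∧ accepts M₂ w)
    accepts-M w = trans (cong (DFA.accept M) (run M₁.start M₂.start w))
      (cong (λ (p , q) → M₁.accept p ∧ M₂.accept q) (pair-combine _ _))
    M-ok : ∀ w → (accepts M w ≡ true) ⇔ (L₁ w × L₂ w)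
    M-ok w = subst (λ b → (b ≡ true) ⇔ _) (sym (accepts-M w)) (⇔.trans ∧≡true⇔ (M₁-ok w ×-⇔ M₂-ok w))

  ∃? : ∀ {n} → Fin n ↔ B → {P : B → Set} → Decidable P → Dec (∃ P)
  ∃? enum {P} P? = map′ (λ (i , p) → to i , p)
    (λ (b , p) → from b , subst P (sym (strictlyInverseˡ b)) p) (any? (P? ∘ to))
    where open Inverse enum

  record NFA (A : Set) : Set₁ where
    field
      State    : Set
      size     : ℕ
      states   : Fin size ↔ State
      Initial  : State → Set
      initial? : Decidable Initial
      Step     : State → A → State → Set
      step?    : ∀ q a q′ → Dec (Step q a q′)
      Final    : State → Set
      final?   : Decidable Final

  module _ {A : Set} (N : NFA A) where
    open NFA N

    infixr 5 _∷_
    data Run : State → List A → State → Set where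
      []  : ∀ {q} → Run q [] q
      _∷_ : ∀ {q a q′ w q″} → Step q a q′ → Run q′ w q″ → Run q (a ∷ w) q″

    Accepts : List A → Set
    Accepts w = ∃₂ λ q q′ → Initial q × Run q w q′ × Final q′

  run-++ : ∀ {N : NFA A} {q q′ q″ u v} → Run N q u q′ → Run N q′ v q″ → Run N q (u ++ v) q″
  run-++ []      r′ = r′
  run-++ (s ∷ r) r′ = s ∷ run-++ r r′

  bit : {P : Set} → Dec P → Fin 2
  bit (yes _) = 1F
  bit (no _)  = 0F

  bit≡1⇔ : {P : Set} (P? : Dec P) → (bit P? ≡ 1F) ⇔ P
  bit≡1⇔ (yes p) = mk⇔ (λ _ → p) (λ _ → refl)
  bit≡1⇔ (no ¬p) = mk⇔ (λ ()) (λ p → ⊥-elim (¬p p))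

  does≡true⇔ : {P : Set} (P? : Dec P) → (does P? ≡ true) ⇔ P
  does≡true⇔ (yes p) = mk⇔ (λ _ → p) (λ _ → refl)
  does≡true⇔ (no ¬p) = mk⇔ (λ ()) (λ p → ⊥-elim (¬p p))

  module Determinise {A : Set} (N : NFA A) where
    open NFA N
    open Inverse states

    -- A set of states is stored as the number below 2 ^ size encoding its characteristic function.
    Subset : Set
    Subset = Fin (2 ^ size)

    _∈_ : State → Subset → Set
    q ∈ X = finToFun X (from q) ≡ 1F

    _∈?_ : ∀ q X → Dec (q ∈ X)
    q ∈? X = finToFun X (from q) ≟ᶠ 1F

    ⟦_⟧ : {P : State → Set} → Decidable P → Subset
    ⟦ P? ⟧ = funToFin (λ i → bit (P? (to i)))

    ∈⟦⟧⇔ : {P : State → Set} (P? : Decidable P) (q : State) → q ∈ ⟦ P? ⟧ ⇔ P q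
    ∈⟦⟧⇔ P? q rewrite finToFun-funToFin (λ i → bit (P? (to i))) (from q)
                    | strictlyInverseˡ q = bit≡1⇔ (P? q)

    successor? : ∀ X a q′ → Dec (∃ λ q → q ∈ X × Step q a q′)
    successor? X a q′ = ∃? states (λ q → q ∈? X ×-dec step? q a q′)

    accepting? : ∀ X → Dec (∃ λ q → q ∈ X × Final q)
    accepting? X = ∃? states (λ q → q ∈? X ×-dec final? q)

    next : Subset → A → Subset
    next X a = ⟦ successor? X a ⟧

    subsetDFA : DFA A
    subsetDFA = record { nStates = 2 ^ size ; start = ⟦ initial? ⟧ ; δ = next ; accept = does ∘ accepting? }

    ∈-run⇔ : ∀ X w q′ → q′ ∈ foldl next X w ⇔ ∃ λ q → q ∈ X × Run N q w q′
    ∈-run⇔ X []      q′ = mk⇔ (λ q′∈X → q′ , q′∈X , []) (λ { (q , q∈X , []) → q∈X })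
    ∈-run⇔ X (a ∷ w) q′ = mk⇔ forward backward
      where
      open Equivalence
      forward : q′ ∈ foldl next (next X a) w → ∃ λ q → q ∈ X × Run N q (a ∷ w) q′
      forward q′∈ with to (∈-run⇔ (next X a) w q′) q′∈
      ... | q₁ , q₁∈ , r with to (∈⟦⟧⇔ (successor? X a) q₁) q₁∈
      ... | q , q∈X , s = q , q∈X , s ∷ r
      backward : (∃ λ q → q ∈ X × Run N q (a ∷ w) q′) → q′ ∈ foldl next (next X a) w
      backward (q , q∈X , s ∷ r) =
        from (∈-run⇔ (next X a) w q′) (_ , from (∈⟦⟧⇔ (successor? X a) _) (q , q∈X , s) , r)

    subsetDFA-accepts : ∀ w → (accepts subsetDFA w ≡ true) ⇔ Accepts N w
    subsetDFA-accepts w = ⇔.trans (does≡true⇔ (accepting? X)) (mk⇔ forward backward)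
      where
      open Equivalence
      X : Subset
      X = foldl next ⟦ initial? ⟧ w
      forward : (∃ λ q′ → q′ ∈ X × Final q′) → Accepts N w
      forward (q′ , q′∈ , fin) with to (∈-run⇔ ⟦ initial? ⟧ w q′) q′∈
      ... | q , q∈ , r = q , q′ , to (∈⟦⟧⇔ initial? q) q∈ , r , fin
      backward : Accepts N w → ∃ λ q′ → q′ ∈ X × Final q′
      backward (q , q′ , ini , r , fin) =
        q′ , from (∈-run⇔ ⟦ initial? ⟧ w q′) (q , from (∈⟦⟧⇔ initial? q) ini , r) , fin

  determinise : (N : NFA A) → Recognisable (Accepts N)
  determinise N = subsetDFA , subsetDFA-accepts
    where open Determinise N

  recognisable-∃ : ∀ {m} {L : List (A × G) → Set} → Fin m ↔ G →
    Recognisable L → Recognisable (λ w → ∃ λ ws → map proj₁ ws ≡ w × L ws)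
  recognisable-∃ {A} {G} {L = L} guesses (M , M-ok) = recognisable-resp accepts⇔ (determinise N)
    where
    open DFA M
    N : NFA A
    N = record
      { State = Fin nStates ; size = nStates ; states = ↔-refl
      ; Initial = _≡ start ; initial? = _≟ᶠ start
      ; Step = λ q a q′ → ∃ λ g → δ q (a , g) ≡ q′
      ; step? = λ q a q′ → ∃? guesses (λ g → δ q (a , g) ≟ᶠ q′)
      ; Final = λ q → accept q ≡ true ; final? = λ q → accept q Bool.≟ true
      }
    run⇒ : ∀ {q w q′} → Run N q w q′ → ∃ λ ws → map proj₁ ws ≡ w × foldl δ q ws ≡ q′
    run⇒ []               = [] , refl , refl
    run⇒ ((g , refl) ∷ r) with run⇒ r
    ... | ws , refl , e = (_ , g) ∷ ws , refl , e
    ⇒run : ∀ {q} ws → Run N q (map proj₁ ws) (foldl δ q ws)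
    ⇒run []             = []
    ⇒run ((a , g) ∷ ws) = (g , refl) ∷ ⇒run ws
    accepts⇔ : ∀ w → Accepts N w ⇔ (∃ λ ws → map proj₁ ws ≡ w × L ws)
    accepts⇔ w = mk⇔ forward backward
      where
      forward : Accepts N w → ∃ λ ws → map proj₁ ws ≡ w × L ws
      forward (q , q′ , refl , r , acc) with run⇒ r
      ... | ws , e , refl = ws , e , Equivalence.to (M-ok ws) acc
      backward : (∃ λ ws → map proj₁ ws ≡ w × L ws) → Accepts N w
      backward (ws , refl , l) = start , _ , refl , ⇒run ws , Equivalence.from (M-ok ws) l

  partialNFA : ∀ {Q : Set} {n} → Fin n ↔ Q → DecidableEquality Q → Q → (Q → A → Maybe Q) → NFA A
  partialNFA {Q = Q} {n} states _≟_ q₀ next = record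
    { State = Q ; size = n ; states = states
    ; Initial = _≡ q₀ ; initial? = _≟ q₀
    ; Step = λ q a q′ → next q a ≡ just q′ ; step? = λ q a q′ → Maybe.≡-dec _≟_ (next q a) (just q′)
    ; Final = λ _ → ⊤ ; final? = λ _ → yes tt
    }

  partialNFA-accepts : ∀ {Q : Set} {n} (states : Fin n ↔ Q) _≟_ q₀ (next : Q → A → Maybe Q) w →
    Accepts (partialNFA states _≟_ q₀ next) w ⇔ ∃ (Run (partialNFA states _≟_ q₀ next) q₀ w)
  partialNFA-accepts states _≟_ q₀ next w =
    mk⇔ (λ { (q , q′ , refl , r , _) → q′ , r }) (λ (q′ , r) → q₀ , q′ , refl , r , tt)

open Automata

module Values where

  open import Data.Nat using (_+_; _*_; _∸_; _≤_; _<_; z≤n; s≤s; s≤s⁻¹)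
  open import Data.Nat.Properties
  open import Data.Nat.Tactic.RingSolver using (solve-∀)
  open import Data.Fin.Properties using (toℕ<n)

  fib-+ : ∀ a b → fib (suc (a + b)) ≡ fib (suc a) * fib (suc b) + fib a * fib b
  fib-+ zero    b = sym (trans (+-identityʳ _) (+-identityʳ _))
  fib-+ (suc a) b = begin
    fib (suc (suc a + b))
      ≡⟨ cong (fib ∘′ suc) (sym (+-suc a b)) ⟩
    fib (suc (a + suc b))
      ≡⟨ fib-+ a (suc b) ⟩
    fib (suc a) * (fib (suc b) + fib b) + fib a * fib (suc b)
      ≡⟨ regroup (fib (suc a)) (fib a) (fib (suc b)) (fib b) ⟩
    (fib (suc a) + fib a) * fib (suc b) + fib (suc a) * fib b ∎
    where
    open ≡-Reasoning
    regroup : ∀ p q r s → p * (r + s) + q * r ≡ (p + q) * r + p * s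
    regroup = solve-∀

  fib-≤-suc : ∀ n → fib n ≤ fib (suc n)
  fib-≤-suc zero    = z≤n
  fib-≤-suc (suc n) = m≤m+n (fib (suc n)) (fib n)

  fib-positive : ∀ n → 0 < fib (suc n)
  fib-positive zero    = s≤s z≤n
  fib-positive (suc n) = ≤-trans (fib-positive n) (m≤m+n _ _)

  fib[2+n]≤2*fib[1+n] : ∀ n → fib (suc (suc n)) ≤ 2 * fib (suc n)
  fib[2+n]≤2*fib[1+n] n = begin
    fib (suc n) + fib n       ≤⟨ +-monoʳ-≤ (fib (suc n)) (fib-≤-suc n) ⟩
    fib (suc n) + fib (suc n) ≡⟨ cong (fib (suc n) +_) (sym (+-identityʳ _)) ⟩
    2 * fib (suc n)           ∎
    where open ≤-Reasoning

  2*fib[1+n]≤fib[3+n] : ∀ n → 2 * fib (suc n) ≤ fib (suc (suc (suc n)))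
  2*fib[1+n]≤fib[3+n] n = begin
    2 * fib (suc n)                 ≡⟨ cong (fib (suc n) +_) (+-identityʳ _) ⟩
    fib (suc n) + fib (suc n)       ≤⟨ +-monoˡ-≤ (fib (suc n)) (fib-≤-suc (suc n)) ⟩
    fib (suc (suc n)) + fib (suc n) ∎
    where open ≤-Reasoning

  2*fib-recurrence : ∀ n → 2 * fib (suc (suc n)) + 2 * fib (suc n) ≡ 2 * fib (suc (suc (suc n)))
  2*fib-recurrence n = sym (*-distribˡ-+ 2 (fib (suc (suc n))) (fib (suc n)))

  fib[1+a]*fib[1+b]≤fib[1+a+b] : ∀ a b → fib (suc a) * fib (suc b) ≤ fib (suc (a + b))
  fib[1+a]*fib[1+b]≤fib[1+a+b] a b =
    subst (fib (suc a) * fib (suc b) ≤_) (sym (fib-+ a b)) (m≤m+n _ (fib a * fib b))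

  valFrom-∷ : ∀ {k} i (d : Fin k) w → valFrom i (d ∷ w) ≡ toℕ d * fib (2 + i) + valFrom (suc i) w
  valFrom-∷ i d w = cong (λ j → toℕ d * fib j + valFrom (suc i) w) (+-comm i 2)

  valFrom-++ : ∀ {k} i (u v : List (Fin k)) → valFrom i (u ++ v) ≡ valFrom i u + valFrom (length u + i) v
  valFrom-++ i []      v = refl
  valFrom-++ i (d ∷ u) v = begin
    toℕ d * fib (i + 2) + valFrom (suc i) (u ++ v)
      ≡⟨ cong (toℕ d * fib (i + 2) +_) (valFrom-++ (suc i) u v) ⟩
    toℕ d * fib (i + 2) + (valFrom (suc i) u + valFrom (length u + suc i) v)
      ≡⟨ sym (+-assoc (toℕ d * fib (i + 2)) _ _) ⟩
    toℕ d * fib (i + 2) + valFrom (suc i) u + valFrom (length u + suc i) v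
      ≡⟨ cong (λ j → toℕ d * fib (i + 2) + valFrom (suc i) u + valFrom j v) (+-suc (length u) i) ⟩
    toℕ d * fib (i + 2) + valFrom (suc i) u + valFrom (suc (length u) + i) v ∎
    where open ≡-Reasoning

  val-++ : ∀ {k} (u v : List (Fin k)) → val (u ++ v) ≡ val u + valFrom (length u) v
  val-++ u v = trans (valFrom-++ 0 u v) (cong (λ j → val u + valFrom j v) (+-identityʳ (length u)))

  valFrom-zeros : ∀ {k} i n → valFrom {suc k} i (replicate n 0F) ≡ 0
  valFrom-zeros i zero    = refl
  valFrom-zeros i (suc n) = valFrom-zeros (suc i) n

  val-++-zeros : ∀ {k} (w : List (Fin (suc k))) n → val (w ++ replicate n 0F) ≡ val w
  val-++-zeros w n = trans (val-++ w _) (trans (cong (val w +_) (valFrom-zeros (length w) n)) (+-identityʳ _))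

  val-++-0d : ∀ {k} (w : List (Fin (suc k))) d →
    val (w ++ 0F ∷ d ∷ []) ≡ val w + toℕ d * fib (suc (length w) + 2)
  val-++-0d w d = trans (val-++ w _) (cong (val w +_) (+-identityʳ _))

  valFrom-map : ∀ {k m} (h : Fin k → Fin m) → (∀ d → toℕ (h d) ≡ toℕ d) →
    ∀ i w → valFrom i (map h w) ≡ valFrom i w
  valFrom-map h h-ok i []      = refl
  valFrom-map h h-ok i (d ∷ w) = cong₂ (λ x y → x * fib (i + 2) + y) (h-ok d) (valFrom-map h h-ok (suc i) w)

  valFrom-bound : ∀ i (w : List (Fin 3)) → valFrom i w + 2 * fib (3 + i) ≤ 2 * fib (3 + (length w + i))
  valFrom-bound i []      = ≤-refl
  valFrom-bound i (d ∷ w) = begin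
    valFrom i (d ∷ w) + 2 * fib (3 + i)
      ≡⟨ cong (_+ 2 * fib (3 + i)) (valFrom-∷ i d w) ⟩
    toℕ d * fib (2 + i) + valFrom (suc i) w + 2 * fib (3 + i)
      ≤⟨ +-monoˡ-≤ _ (+-monoˡ-≤ _ (*-monoˡ-≤ (fib (2 + i)) (s≤s⁻¹ (toℕ<n d)))) ⟩
    2 * fib (2 + i) + valFrom (suc i) w + 2 * fib (3 + i)
      ≡⟨ regroup (fib (2 + i)) (valFrom (suc i) w) (fib (3 + i)) ⟩
    valFrom (suc i) w + 2 * fib (3 + suc i)
      ≤⟨ valFrom-bound (suc i) w ⟩
    2 * fib (3 + (length w + suc i))
      ≡⟨ cong (λ j → 2 * fib (3 + j)) (+-suc (length w) i) ⟩
    2 * fib (3 + (length (d ∷ w) + i)) ∎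
    where
    open ≤-Reasoning
    regroup : ∀ x v y → 2 * x + v + 2 * y ≡ v + 2 * (y + x)
    regroup = solve-∀

  val<fib : (w : List (Fin 3)) → val w < fib (length w + 3 + 2)
  val<fib w = begin-strict
    val w                          <⟨ m<m+n (val w) (s≤s z≤n) ⟩
    val w + 2 * fib 3              ≤⟨ valFrom-bound 0 w ⟩
    2 * fib (3 + (length w + 0))   ≡⟨ cong (λ j → 2 * fib (3 + j)) (+-identityʳ (length w)) ⟩
    2 * fib (3 + length w)         ≤⟨ 2*fib[1+n]≤fib[3+n] (2 + length w) ⟩
    fib (5 + length w)             ≡⟨ cong fib (trans (+-comm 5 (length w)) (sym (+-assoc (length w) 3 2))) ⟩
    fib (length w + 3 + 2)         ∎
    where open ≤-Reasoning

  length-++-≡ : ∀ {A : Set} {L} (w s : List A) → length w ≡ L → length (w ++ s) ≡ length s + L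
  length-++-≡ w s refl = trans (length-++ w) (+-comm (length w) (length s))

  <-+-split : ∀ a b n → n < a + b → n < a ⊎ ∃ λ r → r < b × r + a ≡ n
  <-+-split a b n n<a+b with n <? a
  ... | yes n<a = inj₁ n<a
  ... | no  n≮a = inj₂ (n ∸ a , +-cancelˡ-< a _ b (subst (_< a + b) (sym (m+[n∸m]≡n a≤n)) n<a+b) , m∸n+n≡m a≤n)
    where a≤n = ≮⇒≥ n≮a

open Values

module ValueEquality where

  open import Data.Nat as ℕ using (z≤n; s≤s; s≤s⁻¹)
  import Data.Nat.Properties as ℕ
  open import Data.Integer using (ℤ; +_; -[1+_]; 0ℤ; _+_; _-_; _*_; -_; ∣_∣; _≟_)
  open import Data.Integer.Properties
    using (pos-+; pos-*; *-identityʳ; *-zeroˡ; +-identityʳ; +-identityˡ; +-inverseʳ; +-injective; i-j≡0⇒i≡j;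
           m-n≡m⊖n; ∣m⊝n∣≤m⊔n; ∣i+j∣≤∣i∣+∣j∣; ∣i-j∣≤∣i∣+∣j∣; ∣i*j∣≡∣i∣*∣j∣; ∣-i∣≡∣i∣)
  import Data.Integer.Tactic.RingSolver as ℤ-Ring
  open import Data.Fin using (fromℕ<)
  open import Data.Fin.Properties using (toℕ<n; toℕ-fromℕ<; +↔⊎)

  gap : Fin 3 × Fin 3 → ℤ
  gap (x , y) = + toℕ x - + toℕ y

  -- coeff₁ cs = Σᵢ gap cᵢ · F (i+1) and coeff₀ cs = Σᵢ gap cᵢ · F i.
  coeff₁ coeff₀ : List (Fin 3 × Fin 3) → ℤ
  coeff₁ []       = 0ℤ
  coeff₁ (c ∷ cs) = gap c + coeff₁ cs + coeff₀ cs
  coeff₀ []       = 0ℤ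
  coeff₀ (c ∷ cs) = coeff₁ cs

  valFrom-gap : ∀ i cs → + valFrom i (map proj₁ cs) - + valFrom i (map proj₂ cs)
                       ≡ coeff₁ cs * + fib (suc (suc i)) + coeff₀ cs * + fib (suc i)
  valFrom-gap i []                = refl
  valFrom-gap i (c@(x , y) ∷ cs) = begin
    + valFrom i (x ∷ xs) - + valFrom i (y ∷ ys)
      ≡⟨ cong₂ (λ u v → + u - + v) (valFrom-∷ i x xs) (valFrom-∷ i y ys) ⟩
    + (toℕ x ℕ.* F₂ ℕ.+ valFrom (suc i) xs) - + (toℕ y ℕ.* F₂ ℕ.+ valFrom (suc i) ys)
      ≡⟨ cong₂ _-_ (pos-*-+ (toℕ x) F₂ _) (pos-*-+ (toℕ y) F₂ _) ⟩
    (+ toℕ x * + F₂ + + valFrom (suc i) xs) - (+ toℕ y * + F₂ + + valFrom (suc i) ys)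
      ≡⟨ split (+ toℕ x) (+ toℕ y) (+ F₂) (+ valFrom (suc i) xs) (+ valFrom (suc i) ys) ⟩
    gap c * + F₂ + (+ valFrom (suc i) xs - + valFrom (suc i) ys)
      ≡⟨ cong (λ t → gap c * + F₂ + t) (valFrom-gap (suc i) cs) ⟩
    gap c * + F₂ + (coeff₁ cs * + (F₂ ℕ.+ F₁) + coeff₀ cs * + F₂)
      ≡⟨ cong (λ t → gap c * + F₂ + (coeff₁ cs * t + coeff₀ cs * + F₂)) (pos-+ F₂ F₁) ⟩
    gap c * + F₂ + (coeff₁ cs * (+ F₂ + + F₁) + coeff₀ cs * + F₂)
      ≡⟨ regroup (gap c) (coeff₁ cs) (coeff₀ cs) (+ F₂) (+ F₁) ⟩
    coeff₁ (c ∷ cs) * + F₂ + coeff₀ (c ∷ cs) * + F₁ ∎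
    where
    open ≡-Reasoning
    xs ys : List (Fin 3)
    xs = map proj₁ cs
    ys = map proj₂ cs
    F₂ F₁ : ℕ
    F₂ = fib (suc (suc i))
    F₁ = fib (suc i)
    pos-*-+ : ∀ a f v → + (a ℕ.* f ℕ.+ v) ≡ + a * + f + + v
    pos-*-+ a f v = trans (pos-+ (a ℕ.* f) v) (cong (_+ + v) (pos-* a f))
    split : ∀ a b f u v → (a * f + u) - (b * f + v) ≡ (a - b) * f + (u - v)
    split = ℤ-Ring.solve-∀
    regroup : ∀ g p q f₂ f₁ → g * f₂ + (p * (f₂ + f₁) + q * f₂) ≡ (g + p + q) * f₂ + p * f₁
    regroup = ℤ-Ring.solve-∀

  val-gap : ∀ cs → + val (map proj₁ cs) - + val (map proj₂ cs) ≡ coeff₁ cs + coeff₀ cs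
  val-gap cs = trans (valFrom-gap 0 cs) (cong₂ _+_ (*-identityʳ (coeff₁ cs)) (*-identityʳ (coeff₀ cs)))

  ∣gap∣≤2 : ∀ c → ∣ gap c ∣ ℕ.≤ 2
  ∣gap∣≤2 (x , y) = subst (λ z → ∣ z ∣ ℕ.≤ 2) (sym (m-n≡m⊖n (toℕ x) (toℕ y)))
    (ℕ.≤-trans (∣m⊝n∣≤m⊔n (toℕ x) (toℕ y)) (ℕ.⊔-lub (s≤s⁻¹ (toℕ<n x)) (s≤s⁻¹ (toℕ<n y))))

  ∣gap*m∣≤2*m : ∀ c m → ∣ gap c * + m ∣ ℕ.≤ 2 ℕ.* m
  ∣gap*m∣≤2*m c m = subst (ℕ._≤ 2 ℕ.* m) (sym (∣i*j∣≡∣i∣*∣j∣ (gap c) (+ m))) (ℕ.*-monoˡ-≤ m (∣gap∣≤2 c))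

  -- A second linear form in the coefficients; with the equation of equal values it determines them.
  cross : List (Fin 3 × Fin 3) → ℤ
  cross cs = coeff₁ cs * + fib (length cs) - coeff₀ cs * + fib (suc (length cs))

  cross-∷ : ∀ c cs → cross (c ∷ cs) ≡ gap c * + fib (suc (length cs)) - cross cs
  cross-∷ c cs =
    trans (cong (λ t → coeff₁ (c ∷ cs) * + fib (suc n) - coeff₁ cs * t) (pos-+ (fib (suc n)) (fib n)))
          (regroup (gap c) (coeff₁ cs) (coeff₀ cs) (+ fib (suc n)) (+ fib n))
    where
    n : ℕ
    n = length cs
    regroup : ∀ g p q f₁ f₀ → (g + p + q) * f₁ - p * (f₁ + f₀) ≡ g * f₁ - (p * f₀ - q * f₁)
    regroup = ℤ-Ring.solve-∀

  ∣cross∣≤ : ∀ cs → ∣ cross cs ∣ ℕ.≤ 2 ℕ.* fib (suc (suc (length cs)))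
  ∣cross∣≤ []       = z≤n
  ∣cross∣≤ (c ∷ cs) = begin
    ∣ cross (c ∷ cs) ∣                              ≡⟨ cong ∣_∣ (cross-∷ c cs) ⟩
    ∣ gap c * + fib (suc n) - cross cs ∣            ≤⟨ ∣i-j∣≤∣i∣+∣j∣ (gap c * + fib (suc n)) (cross cs) ⟩
    ∣ gap c * + fib (suc n) ∣ ℕ.+ ∣ cross cs ∣      ≤⟨ ℕ.+-mono-≤ (∣gap*m∣≤2*m c (fib (suc n))) (∣cross∣≤ cs) ⟩
    2 ℕ.* fib (suc n) ℕ.+ 2 ℕ.* fib (suc (suc n))  ≡⟨ ℕ.+-comm (2 ℕ.* fib (suc n)) _ ⟩
    2 ℕ.* fib (suc (suc n)) ℕ.+ 2 ℕ.* fib (suc n)  ≡⟨ 2*fib-recurrence n ⟩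
    2 ℕ.* fib (suc (suc (suc n)))                  ∎
    where
    open ℕ.≤-Reasoning
    n : ℕ
    n = length cs

  cramer : ∀ X A B f₂ f₁ p q → X + A * f₂ + B * f₁ ≡ 0ℤ →
    A * (f₂ * p + f₁ * q) ≡ (A * q - B * p) * f₁ - X * p ×
    B * (f₂ * p + f₁ * q) ≡ - (X * q) - (A * q - B * p) * f₂
  cramer X A B f₂ f₁ p q X+A+B≡0 =
    trans (expand₁ X A B f₂ f₁ p q) (drop-zero _ p) , trans (expand₂ X A B f₂ f₁ p q) (drop-zero _ q)
    where
    drop-zero : ∀ u r → u + (X + A * f₂ + B * f₁) * r ≡ u
    drop-zero u r =
      trans (cong (λ z → u + z * r) X+A+B≡0) (trans (cong (λ t → u + t) (*-zeroˡ r)) (+-identityʳ u))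
    expand₁ : ∀ x a b f₂ f₁ p q →
      a * (f₂ * p + f₁ * q) ≡ (a * q - b * p) * f₁ - x * p + (x + a * f₂ + b * f₁) * p
    expand₁ = ℤ-Ring.solve-∀
    expand₂ : ∀ x a b f₂ f₁ p q →
      b * (f₂ * p + f₁ * q) ≡ - (x * q) - (a * q - b * p) * f₂ + (x + a * f₂ + b * f₁) * q
    expand₂ = ℤ-Ring.solve-∀

  ∣Z*m∣≤4*T : ∀ Z a m T → ∣ Z ∣ ℕ.≤ 2 ℕ.* a → a ℕ.* m ℕ.≤ 2 ℕ.* T → ∣ Z * + m ∣ ℕ.≤ 4 ℕ.* T
  ∣Z*m∣≤4*T Z a m T ∣Z∣≤ am≤ = begin
    ∣ Z * + m ∣        ≡⟨ ∣i*j∣≡∣i∣*∣j∣ Z (+ m) ⟩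
    ∣ Z ∣ ℕ.* m        ≤⟨ ℕ.*-monoˡ-≤ m ∣Z∣≤ ⟩
    2 ℕ.* a ℕ.* m      ≡⟨ ℕ.*-assoc 2 a m ⟩
    2 ℕ.* (a ℕ.* m)    ≤⟨ ℕ.*-monoʳ-≤ 2 am≤ ⟩
    2 ℕ.* (2 ℕ.* T)    ≡⟨ ℕ.*-assoc 2 2 T ⟨
    4 ℕ.* T            ∎
    where open ℕ.≤-Reasoning

  ∣Z∣≤8 : ∀ Z T → 0 ℕ.< T → ∣ Z * + T ∣ ℕ.≤ 4 ℕ.* T ℕ.+ 4 ℕ.* T → ∣ Z ∣ ℕ.≤ 8
  ∣Z∣≤8 Z T T>0 ∣ZT∣≤ = ℕ.*-cancelʳ-≤ ∣ Z ∣ 8 T {{ℕ.>-nonZero T>0}}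
    (subst₂ ℕ._≤_ (∣i*j∣≡∣i∣*∣j∣ Z (+ T)) (sym (ℕ.*-distribʳ-+ T 4 4)) ∣ZT∣≤)

  -- Cramer's rule for  A · F (k+2) + B · F (k+1) = - X  and  A · F n - B · F (n+1) = Y, a system of
  -- determinant - F (k+n+2): the four products of Fibonacci numbers in the solution are all at most
  -- 2 F (k+n+2), so |A| · F (k+n+2) and |B| · F (k+n+2) are at most 8 F (k+n+2).
  coeffs-bounded : ∀ k n (X A B : ℤ) →
    X + A * + fib (suc (suc k)) + B * + fib (suc k) ≡ 0ℤ →
    ∣ X ∣ ℕ.≤ 2 ℕ.* fib (suc (suc (suc k))) →
    ∣ A * + fib n - B * + fib (suc n) ∣ ℕ.≤ 2 ℕ.* fib (suc (suc n)) →
    ∣ A ∣ ℕ.≤ 8 × ∣ B ∣ ℕ.≤ 8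
  coeffs-bounded k n X A B X+A+B≡0 ∣X∣≤ ∣Y∣≤ = ∣Z∣≤8 A T T>0 ∣AT∣≤ , ∣Z∣≤8 B T T>0 ∣BT∣≤
    where
    Y : ℤ
    Y = A * + fib n - B * + fib (suc n)
    T : ℕ
    T = fib (suc (suc (k ℕ.+ n)))
    T>0 : 0 ℕ.< T
    T>0 = fib-positive (suc (k ℕ.+ n))
    f₂ f₁ p q : ℤ
    f₂ = + fib (suc (suc k))
    f₁ = + fib (suc k)
    p  = + fib (suc n)
    q  = + fib n
    T≡ : + T ≡ f₂ * p + f₁ * q
    T≡ = trans (cong +_ (fib-+ (suc k) n))
               (trans (pos-+ (fib (suc (suc k)) ℕ.* fib (suc n)) (fib (suc k) ℕ.* fib n))
                      (cong₂ _+_ (pos-* (fib (suc (suc k))) (fib (suc n))) (pos-* (fib (suc k)) (fib n))))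
    A*T≡ : A * + T ≡ Y * f₁ - X * p
    A*T≡ = trans (cong (A *_) T≡) (proj₁ (cramer X A B f₂ f₁ p q X+A+B≡0))
    B*T≡ : B * + T ≡ - (X * q) - Y * f₂
    B*T≡ = trans (cong (B *_) T≡) (proj₂ (cramer X A B f₂ f₁ p q X+A+B≡0))
    F₃₊ₖ F₂₊ₙ : ℕ
    F₃₊ₖ = fib (suc (suc (suc k)))
    F₂₊ₙ = fib (suc (suc n))
    F₃₊ₖ*F₁₊ₙ≤ : F₃₊ₖ ℕ.* fib (suc n) ℕ.≤ 2 ℕ.* T
    F₃₊ₖ*F₁₊ₙ≤ = ℕ.≤-trans (fib[1+a]*fib[1+b]≤fib[1+a+b] (suc (suc k)) n) (fib[2+n]≤2*fib[1+n] (suc (k ℕ.+ n)))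
    F₃₊ₖ*Fₙ≤ : F₃₊ₖ ℕ.* fib n ℕ.≤ 2 ℕ.* T
    F₃₊ₖ*Fₙ≤ = ℕ.≤-trans (ℕ.*-monoʳ-≤ F₃₊ₖ (fib-≤-suc n)) F₃₊ₖ*F₁₊ₙ≤
    F₂₊ₙ*F₁₊ₖ≤ : F₂₊ₙ ℕ.* fib (suc k) ℕ.≤ 2 ℕ.* T
    F₂₊ₙ*F₁₊ₖ≤ = ℕ.≤-trans (fib[1+a]*fib[1+b]≤fib[1+a+b] (suc n) k)
      (subst (ℕ._≤ 2 ℕ.* T) (cong (fib ∘′ suc ∘′ suc) (ℕ.+-comm k n)) (ℕ.m≤m+n T (T ℕ.+ 0)))
    F₂₊ₙ*F₂₊ₖ≤ : F₂₊ₙ ℕ.* fib (suc (suc k)) ℕ.≤ 2 ℕ.* T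
    F₂₊ₙ*F₂₊ₖ≤ = ℕ.≤-trans (fib[1+a]*fib[1+b]≤fib[1+a+b] (suc n) (suc k))
      (subst (ℕ._≤ 2 ℕ.* T) (cong (fib ∘′ suc ∘′ suc) (sym (trans (ℕ.+-suc n k) (cong suc (ℕ.+-comm n k)))))
        (fib[2+n]≤2*fib[1+n] (suc (k ℕ.+ n))))
    ∣AT∣≤ : ∣ A * + T ∣ ℕ.≤ 4 ℕ.* T ℕ.+ 4 ℕ.* T
    ∣AT∣≤ = begin
      ∣ A * + T ∣               ≡⟨ cong ∣_∣ A*T≡ ⟩
      ∣ Y * f₁ - X * p ∣        ≤⟨ ∣i-j∣≤∣i∣+∣j∣ (Y * f₁) (X * p) ⟩
      ∣ Y * f₁ ∣ ℕ.+ ∣ X * p ∣  ≤⟨ ℕ.+-mono-≤ (∣Z*m∣≤4*T Y F₂₊ₙ _ T ∣Y∣≤ F₂₊ₙ*F₁₊ₖ≤)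
                                              (∣Z*m∣≤4*T X F₃₊ₖ _ T ∣X∣≤ F₃₊ₖ*F₁₊ₙ≤) ⟩
      4 ℕ.* T ℕ.+ 4 ℕ.* T       ∎
      where open ℕ.≤-Reasoning
    ∣BT∣≤ : ∣ B * + T ∣ ℕ.≤ 4 ℕ.* T ℕ.+ 4 ℕ.* T
    ∣BT∣≤ = begin
      ∣ B * + T ∣                   ≡⟨ cong ∣_∣ B*T≡ ⟩
      ∣ - (X * q) - Y * f₂ ∣        ≤⟨ ∣i-j∣≤∣i∣+∣j∣ (- (X * q)) (Y * f₂) ⟩
      ∣ - (X * q) ∣ ℕ.+ ∣ Y * f₂ ∣  ≡⟨ cong (ℕ._+ ∣ Y * f₂ ∣) (∣-i∣≡∣i∣ (X * q)) ⟩
      ∣ X * q ∣ ℕ.+ ∣ Y * f₂ ∣      ≤⟨ ℕ.+-mono-≤ (∣Z*m∣≤4*T X F₃₊ₖ _ T ∣X∣≤ F₃₊ₖ*Fₙ≤)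
                                                  (∣Z*m∣≤4*T Y F₂₊ₙ _ T ∣Y∣≤ F₂₊ₙ*F₂₊ₖ≤) ⟩
      4 ℕ.* T ℕ.+ 4 ℕ.* T           ∎
      where open ℕ.≤-Reasoning

  Bounded : Set
  Bounded = Fin 9 ⊎ Fin 8

  ⟦_⟧ : Bounded → ℤ
  ⟦ inj₁ m ⟧ = + toℕ m
  ⟦ inj₂ m ⟧ = -[1+ toℕ m ]

  bounded : ∀ z → ∣ z ∣ ℕ.≤ 8 → ∃ λ b → ⟦ b ⟧ ≡ z
  bounded (+ m)    m≤8 = inj₁ (fromℕ< (s≤s m≤8)) , cong +_ (toℕ-fromℕ< _)
  bounded -[1+ m ] m<8 = inj₂ (fromℕ< m<8) , cong -[1+_] (toℕ-fromℕ< _)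

  -- A state (a , b) guesses the coefficients (coeff₁ , coeff₀) of the unread suffix.
  valueEqualityNFA : NFA (Fin 3 × Fin 3)
  valueEqualityNFA = record
    { State    = Bounded × Bounded
    ; size     = 17 ℕ.* 17
    ; states   = ↔-trans *↔× (+↔⊎ ×-↔ +↔⊎)
    ; Initial  = λ (a , b) → ⟦ a ⟧ + ⟦ b ⟧ ≡ 0ℤ
    ; initial? = λ (a , b) → ⟦ a ⟧ + ⟦ b ⟧ ≟ 0ℤ
    ; Step     = λ (a , b) c (a′ , b′) → ⟦ a ⟧ ≡ gap c + ⟦ a′ ⟧ + ⟦ b′ ⟧ × ⟦ b ⟧ ≡ ⟦ a′ ⟧
    ; step?    = λ (a , b) c (a′ , b′) → (⟦ a ⟧ ≟ gap c + ⟦ a′ ⟧ + ⟦ b′ ⟧) ×-dec (⟦ b ⟧ ≟ ⟦ a′ ⟧)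
    ; Final    = λ (a , b) → ⟦ a ⟧ ≡ 0ℤ × ⟦ b ⟧ ≡ 0ℤ
    ; final?   = λ (a , b) → (⟦ a ⟧ ≟ 0ℤ) ×-dec (⟦ b ⟧ ≟ 0ℤ)
    }

  open NFA valueEqualityNFA using (Final)

  run⇒coeffs : ∀ {a b cs q′} → Run valueEqualityNFA (a , b) cs q′ → Final q′ →
    ⟦ a ⟧ ≡ coeff₁ cs × ⟦ b ⟧ ≡ coeff₀ cs
  run⇒coeffs []                               fin = fin
  run⇒coeffs {cs = c ∷ cs} ((a≡ , b≡) ∷ r) fin with run⇒coeffs r fin
  ... | a′≡ , b′≡ = trans a≡ (cong₂ (λ u v → gap c + u + v) a′≡ b′≡) , trans b≡ a′≡

  coeffs⇒run : ∀ k X cs →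
    X + coeff₁ cs * + fib (suc (suc k)) + coeff₀ cs * + fib (suc k) ≡ 0ℤ →
    ∣ X ∣ ℕ.≤ 2 ℕ.* fib (suc (suc (suc k))) →
    ∃₂ λ a b → ⟦ a ⟧ ≡ coeff₁ cs × ⟦ b ⟧ ≡ coeff₀ cs × ∃ λ q′ → Run valueEqualityNFA (a , b) cs q′ × Final q′
  coeffs⇒run k X []       _   _    = inj₁ 0F , inj₁ 0F , refl , refl , _ , [] , refl , refl
  coeffs⇒run k X (c ∷ cs) X≡0 ∣X∣≤ =
    let ∣A∣≤ , ∣B∣≤ = coeffs-bounded k (length (c ∷ cs)) X A B X≡0 ∣X∣≤ (∣cross∣≤ (c ∷ cs))
        a , a≡ = bounded A ∣A∣≤
        b , b≡ = bounded B ∣B∣≤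
        a′ , b′ , a′≡ , b′≡ , q′ , r , fin = coeffs⇒run (suc k) X′ cs X′≡0 ∣X′∣≤
    in a , b , a≡ , b≡ , q′ ,
       (trans a≡ (sym (cong₂ (λ u v → gap c + u + v) a′≡ b′≡)) , trans b≡ (sym a′≡)) ∷ r , fin
    where
    F₂ F₁ : ℕ
    F₂ = fib (suc (suc k))
    F₁ = fib (suc k)
    A B X′ : ℤ
    A = coeff₁ (c ∷ cs)
    B = coeff₀ (c ∷ cs)
    X′ = X + gap c * + F₂
    X′≡0 : X′ + coeff₁ cs * + fib (suc (suc (suc k))) + coeff₀ cs * + F₂ ≡ 0ℤ
    X′≡0 = begin
      X′ + coeff₁ cs * + (F₂ ℕ.+ F₁) + coeff₀ cs * + F₂
        ≡⟨ cong (λ t → X′ + coeff₁ cs * t + coeff₀ cs * + F₂) (pos-+ F₂ F₁) ⟩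
      X′ + coeff₁ cs * (+ F₂ + + F₁) + coeff₀ cs * + F₂
        ≡⟨ regroup X (gap c) (coeff₁ cs) (coeff₀ cs) (+ F₂) (+ F₁) ⟩
      X + A * + F₂ + B * + F₁
        ≡⟨ X≡0 ⟩
      0ℤ ∎
      where
      open ≡-Reasoning
      regroup : ∀ x g p q f₂ f₁ → x + g * f₂ + p * (f₂ + f₁) + q * f₂ ≡ x + (g + p + q) * f₂ + p * f₁
      regroup = ℤ-Ring.solve-∀
    ∣X′∣≤ : ∣ X′ ∣ ℕ.≤ 2 ℕ.* fib (suc (suc (suc (suc k))))
    ∣X′∣≤ = begin
      ∣ X + gap c * + F₂ ∣                            ≤⟨ ∣i+j∣≤∣i∣+∣j∣ X (gap c * + F₂) ⟩
      ∣ X ∣ ℕ.+ ∣ gap c * + F₂ ∣                      ≤⟨ ℕ.+-mono-≤ ∣X∣≤ (∣gap*m∣≤2*m c F₂) ⟩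
      2 ℕ.* fib (suc (suc (suc k))) ℕ.+ 2 ℕ.* F₂      ≡⟨ 2*fib-recurrence (suc k) ⟩
      2 ℕ.* fib (suc (suc (suc (suc k))))            ∎
      where open ℕ.≤-Reasoning

  coeffs-sum≡0⇔ : ∀ cs → (coeff₁ cs + coeff₀ cs ≡ 0ℤ) ⇔ (val (map proj₁ cs) ≡ val (map proj₂ cs))
  coeffs-sum≡0⇔ cs = mk⇔
    (λ sum≡0 → +-injective (i-j≡0⇒i≡j _ _ (trans (val-gap cs) sum≡0)))
    (λ v≡v → trans (sym (val-gap cs))
                   (trans (cong (λ v → + v - + val (map proj₂ cs)) v≡v) (+-inverseʳ (+ val (map proj₂ cs)))))

  val-≡-recognisable : Recognisable (λ cs → val (map proj₁ cs) ≡ val (map proj₂ cs))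
  val-≡-recognisable = recognisable-resp accepts⇔ (determinise valueEqualityNFA)
    where
    open Equivalence
    accepts⇔ : ∀ cs → Accepts valueEqualityNFA cs ⇔ (val (map proj₁ cs) ≡ val (map proj₂ cs))
    accepts⇔ cs = mk⇔ forward backward
      where
      forward : Accepts valueEqualityNFA cs → val (map proj₁ cs) ≡ val (map proj₂ cs)
      forward ((a , b) , q′ , a+b≡0 , r , fin) =
        let a≡ , b≡ = run⇒coeffs r fin
        in to (coeffs-sum≡0⇔ cs) (trans (sym (cong₂ _+_ a≡ b≡)) a+b≡0)
      backward : val (map proj₁ cs) ≡ val (map proj₂ cs) → Accepts valueEqualityNFA cs
      backward v≡v =
        let a , b , a≡ , b≡ , q′ , r , fin = coeffs⇒run 0 0ℤ cs start≡0 z≤n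
        in (a , b) , q′ , trans (cong₂ _+_ a≡ b≡) sum≡0 , r , fin
        where
        sum≡0 : coeff₁ cs + coeff₀ cs ≡ 0ℤ
        sum≡0 = from (coeffs-sum≡0⇔ cs) v≡v
        start≡0 : 0ℤ + coeff₁ cs * + 1 + coeff₀ cs * + 1 ≡ 0ℤ
        start≡0 =
          trans (cong₂ _+_ (trans (+-identityˡ _) (*-identityʳ (coeff₁ cs))) (*-identityʳ (coeff₀ cs))) sum≡0

  val-map-≡-recognisable : {B : Set} (f g : B → Fin 3) → Recognisable (λ ws → val (map f ws) ≡ val (map g ws))
  val-map-≡-recognisable f g = recognisable-resp
    (λ ws → subst₂ (λ u v → (val u ≡ val v) ⇔ (val (map f ws) ≡ val (map g ws))) (map-∘ ws) (map-∘ ws) ⇔.refl)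
    (recognisable-preimage < f , g > val-≡-recognisable)

open ValueEquality using (val-map-≡-recognisable)

module Synchronisation where

  open import Data.Nat using (_+_; _<_; pred)

  record NumerationSystem : Set₁ where
    field
      digits             : ℕ
      Valid              : List (Fin digits) → Set
      digit              : Fin digits → Fin 3
      toℕ-digit          : ∀ d → toℕ (digit d) ≡ toℕ d
      valid-recognisable : Recognisable Valid
      representation     : ∀ L n → n < fib (L + 2) → ∃ λ w → length w ≡ L × Valid w × val w ≡ n

    val-digit : ∀ u → val (map digit u) ≡ val u
    val-digit = valFrom-map digit toℕ-digit 0

  Graph : (ℕ → ℕ) → List (Fin 3 × Fin 3) → Set
  Graph f w = f (val (map proj₁ w)) ≡ val (map proj₂ w)

  map-proj-zip : ∀ {A B : Set} (xs : List A) (ys : List B) → length xs ≡ length ys →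
    map proj₁ (zip xs ys) ≡ xs × map proj₂ (zip xs ys) ≡ ys
  map-proj-zip []       []       _ = refl , refl
  map-proj-zip (x ∷ xs) (y ∷ ys) e with map-proj-zip xs ys (cong pred e)
  ... | e₁ , e₂ = cong (x ∷_) e₁ , cong (y ∷_) e₂

  module _ (S : NumerationSystem) (f : ℕ → ℕ) where
    open NumerationSystem S

    ValidGraph : List (Fin digits × Fin digits) → Set
    ValidGraph u = Valid (map proj₁ u) × Valid (map proj₂ u) × f (val (map proj₁ u)) ≡ val (map proj₂ u)

    graph⇒synchronised : Recognisable (Graph f) → Synchronised digits Valid f
    graph⇒synchronised graph = recognisable-resp validGraph⇔
      (recognisable-∩ (recognisable-preimage proj₁ valid-recognisable)
        (recognisable-∩ (recognisable-preimage proj₂ valid-recognisable)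
          (recognisable-preimage (Product.map digit digit) graph)))
      where
      val-digits₁ : ∀ w → val (map proj₁ (map (Product.map digit digit) w)) ≡ val (map proj₁ w)
      val-digits₁ w = trans (cong val (trans (sym (map-∘ w)) (map-∘ w))) (val-digit (map proj₁ w))
      val-digits₂ : ∀ w → val (map proj₂ (map (Product.map digit digit) w)) ≡ val (map proj₂ w)
      val-digits₂ w = trans (cong val (trans (sym (map-∘ w)) (map-∘ w))) (val-digit (map proj₂ w))
      validGraph⇔ : ∀ w →
        (Valid (map proj₁ w) × Valid (map proj₂ w) × Graph f (map (Product.map digit digit) w)) ⇔ ValidGraph w
      validGraph⇔ w = ⇔.refl ×-⇔ ⇔.refl ×-⇔
        subst₂ (λ x y → (f x ≡ y) ⇔ (f (val (map proj₁ w)) ≡ val (map proj₂ w)))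
          (sym (val-digits₁ w)) (sym (val-digits₂ w)) ⇔.refl

    Letter : Set
    Letter = (Fin 3 × Fin 3) × (Fin digits × Fin digits)

    read₁ read₂ guess₁ guess₂ : Letter → Fin 3
    read₁  = proj₁ ∘ proj₁
    read₂  = proj₂ ∘ proj₁
    guess₁ = digit ∘ proj₁ ∘ proj₂
    guess₂ = digit ∘ proj₂ ∘ proj₂

    Matches : List Letter → Set
    Matches ws = ValidGraph (map proj₂ ws) ×
                 val (map read₁ ws) ≡ val (map guess₁ ws) × val (map read₂ ws) ≡ val (map guess₂ ws)

    padding : List (Fin 3 × Fin 3)
    padding = replicate 3 (0F , 0F)

    val-read : ∀ (p : Fin 3 × Fin 3 → Fin 3) → p (0F , 0F) ≡ 0F →
      ∀ w (ws : List Letter) → map proj₁ ws ≡ w ++ padding → val (map (p ∘ proj₁) ws) ≡ val (map p w)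
    val-read p p0 w ws ws≡ = begin
      val (map (p ∘ proj₁) ws)         ≡⟨ cong val (map-∘ {g = p} {f = proj₁} ws) ⟩
      val (map p (map proj₁ ws))       ≡⟨ cong (val ∘ map p) ws≡ ⟩
      val (map p (w ++ padding))       ≡⟨ cong val (map-++ p w padding) ⟩
      val (map p w ++ map p padding)   ≡⟨ cong (λ d → val (map p w ++ d ∷ d ∷ d ∷ [])) p0 ⟩
      val (map p w ++ replicate 3 0F)  ≡⟨ val-++-zeros (map p w) 3 ⟩
      val (map p w)                    ∎
      where open ≡-Reasoning

    val-guess : ∀ (p : Fin digits × Fin digits → Fin digits) (ws : List Letter) →
      val (map (digit ∘ p ∘ proj₂) ws) ≡ val (map p (map proj₂ ws))
    val-guess p ws =
      trans (cong val (trans (map-∘ {g = digit} ws) (cong (map digit) (map-∘ {g = p} {f = proj₂} ws))))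
            (val-digit (map p (map proj₂ ws)))

    matches⇒graph : ∀ w (ws : List Letter) → map proj₁ ws ≡ w ++ padding → Matches ws → Graph f w
    matches⇒graph w ws ws≡ ((_ , _ , f-u≡v) , read₁≡ , read₂≡) = begin
      f (val (map proj₁ w))               ≡⟨ cong f (sym (val-read proj₁ refl w ws ws≡)) ⟩
      f (val (map read₁ ws))              ≡⟨ cong f read₁≡ ⟩
      f (val (map guess₁ ws))             ≡⟨ cong f (val-guess proj₁ ws) ⟩
      f (val (map proj₁ (map proj₂ ws)))  ≡⟨ f-u≡v ⟩
      val (map proj₂ (map proj₂ ws))      ≡⟨ sym (val-guess proj₂ ws) ⟩
      val (map guess₂ ws)                 ≡⟨ sym read₂≡ ⟩
      val (map read₂ ws)                  ≡⟨ val-read proj₂ refl w ws ws≡ ⟩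
      val (map proj₂ w)                   ∎
      where open ≡-Reasoning

    representation-of : (x : List (Fin 3)) → ∃ λ u → length u ≡ length x + 3 × Valid u × val u ≡ val x
    representation-of x = representation (length x + 3) (val x) (val<fib x)

    zip-matches : ∀ w u v → length u ≡ length w + 3 → length v ≡ length w + 3 →
      val u ≡ val (map proj₁ w) → val v ≡ val (map proj₂ w) → ValidGraph (zip u v) →
      map proj₁ (zip (w ++ padding) (zip u v)) ≡ w ++ padding × Matches (zip (w ++ padding) (zip u v))
    zip-matches w u v lu lv u≡ v≡ valid-uv =
      ws₁≡ , subst ValidGraph (sym ws₂≡) valid-uv ,
      read≡guess proj₁ refl proj₁ u≡ uv₁≡ , read≡guess proj₂ refl proj₂ v≡ uv₂≡
      where
      ws : List Letter
      ws = zip (w ++ padding) (zip u v)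
      uv₁≡ : map proj₁ (zip u v) ≡ u
      uv₁≡ = proj₁ (map-proj-zip u v (trans lu (sym lv)))
      uv₂≡ : map proj₂ (zip u v) ≡ v
      uv₂≡ = proj₂ (map-proj-zip u v (trans lu (sym lv)))
      length-uv : length (zip u v) ≡ length w + 3
      length-uv = trans (sym (length-map proj₁ (zip u v))) (trans (cong length uv₁≡) lu)
      ws₁≡ : map proj₁ ws ≡ w ++ padding
      ws₁≡ = proj₁ (map-proj-zip (w ++ padding) (zip u v) (trans (length-++ w) (sym length-uv)))
      ws₂≡ : map proj₂ ws ≡ zip u v
      ws₂≡ = proj₂ (map-proj-zip (w ++ padding) (zip u v) (trans (length-++ w) (sym length-uv)))
      read≡guess : ∀ p → p (0F , 0F) ≡ 0F → ∀ q {x : List (Fin digits)} →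
        val x ≡ val (map p w) → map q (zip u v) ≡ x → val (map (p ∘ proj₁) ws) ≡ val (map (digit ∘ q ∘ proj₂) ws)
      read≡guess p p0 q {x} x≡ q≡ = begin
        val (map (p ∘ proj₁) ws)          ≡⟨ val-read p p0 w ws ws₁≡ ⟩
        val (map p w)                     ≡⟨ sym x≡ ⟩
        val x                             ≡⟨ cong val (sym q≡) ⟩
        val (map q (zip u v))             ≡⟨ cong (val ∘ map q) (sym ws₂≡) ⟩
        val (map q (map proj₂ ws))        ≡⟨ sym (val-guess q ws) ⟩
        val (map (digit ∘ q ∘ proj₂) ws)  ∎
        where open ≡-Reasoning

    graph⇒matches : ∀ w → Graph f w → ∃ λ ws → map proj₁ ws ≡ w ++ padding × Matches ws
    graph⇒matches w f-w₁≡w₂ =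
      let u , lu , u-valid , u≡ = representation-of (map proj₁ w)
          v , lv , v-valid , v≡ = representation-of (map proj₂ w)
          lu′ = trans lu (cong (_+ 3) (length-map proj₁ w))
          lv′ = trans lv (cong (_+ 3) (length-map proj₂ w))
          uv₁≡ , uv₂≡ = map-proj-zip u v (trans lu′ (sym lv′))
          f-u≡v = begin
            f (val (map proj₁ (zip u v)))  ≡⟨ cong (f ∘ val) uv₁≡ ⟩
            f (val u)                      ≡⟨ cong f u≡ ⟩
            f (val (map proj₁ w))          ≡⟨ f-w₁≡w₂ ⟩
            val (map proj₂ w)              ≡⟨ sym v≡ ⟩
            val v                          ≡⟨ cong val (sym uv₂≡) ⟩
            val (map proj₂ (zip u v))      ∎
      in _ , zip-matches w u v lu′ lv′ u≡ v≡
               (subst Valid (sym uv₁≡) u-valid , subst Valid (sym uv₂≡) v-valid , f-u≡v)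
      where open ≡-Reasoning

    synchronised⇒graph : Synchronised digits Valid f → Recognisable (Graph f)
    synchronised⇒graph sync = recognisable-resp graph⇔
      (recognisable-quotient padding (recognisable-∃ *↔× matches-recognisable))
      where
      matches-recognisable : Recognisable Matches
      matches-recognisable = recognisable-∩ (recognisable-preimage proj₂ sync)
        (recognisable-∩ (val-map-≡-recognisable read₁ guess₁) (val-map-≡-recognisable read₂ guess₂))
      graph⇔ : ∀ w → (∃ λ ws → map proj₁ ws ≡ w ++ padding × Matches ws) ⇔ Graph f w
      graph⇔ w = mk⇔ (λ (ws , ws≡ , m) → matches⇒graph w ws ws≡ m) (graph⇒matches w)

    synchronised⇔graph : Synchronised digits Valid f ⇔ Recognisable (Graph f)
    synchronised⇔graph = mk⇔ synchronised⇒graph graph⇒synchronised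

open Synchronisation

module Zeckendorf where

  open import Data.Nat using (_+_; _<_; s≤s)
  open import Data.Nat.Properties using (*-identityˡ)
  open import Data.Fin using (inject₁)
  open import Data.Fin.Properties using (toℕ-inject₁) renaming (_≟_ to _≟ᶠ_)

  zeckendorf-∷ : ∀ p w → IsZeckendorf (p ∷ w) ⇔ ((toℕ p ≡ 1 → dig w 0 ≡ 1 → ⊥) × IsZeckendorf w)
  zeckendorf-∷ p w = mk⇔ (λ z → z 0 , z ∘ suc) (λ (head , tail) → λ { zero → head ; (suc i) → tail i })

  next : Fin 2 → Fin 2 → Maybe (Fin 2)
  next 1F 1F = nothing
  next _  d  = just d

  next⇔ : ∀ p d {q} → next p d ≡ just q ⇔ (q ≡ d × (toℕ p ≡ 1 → toℕ d ≡ 1 → ⊥))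
  next⇔ 0F d  = mk⇔ (λ { refl → refl , λ () }) (λ { (refl , _) → refl })
  next⇔ 1F 0F = mk⇔ (λ { refl → refl , λ _ () }) (λ { (refl , _) → refl })
  next⇔ 1F 1F = mk⇔ (λ ()) (λ (_ , no-11) → ⊥-elim (no-11 refl refl))

  next-0 : ∀ p → next p 0F ≡ just 0F
  next-0 0F = refl
  next-0 1F = refl

  zeckendorfNFA : NFA (Fin 2)
  zeckendorfNFA = partialNFA ↔-refl _≟ᶠ_ 0F next

  runs⇔zeckendorf : ∀ p w → ∃ (Run zeckendorfNFA p w) ⇔ IsZeckendorf (p ∷ w)
  runs⇔zeckendorf p []      = mk⇔ (λ _ → λ { zero _ () ; (suc i) () }) (λ _ → p , [])
  runs⇔zeckendorf p (d ∷ w) = mk⇔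
    (λ { (q , s ∷ r) → let q₁≡d , no-11 = to (next⇔ p d) s
                           r′ = subst (λ q₁ → Run zeckendorfNFA q₁ w q) q₁≡d r
                       in from (zeckendorf-∷ p (d ∷ w)) (no-11 , to (runs⇔zeckendorf d w) (q , r′)) })
    (λ z → let no-11 , z′ = to (zeckendorf-∷ p (d ∷ w)) z
               q , r = from (runs⇔zeckendorf d w) z′
           in q , from (next⇔ p d) (refl , no-11) ∷ r)
    where open Equivalence

  runs⇔zeckendorf₀ : ∀ w → ∃ (Run zeckendorfNFA 0F w) ⇔ IsZeckendorf w
  runs⇔zeckendorf₀ w = ⇔.trans (runs⇔zeckendorf 0F w)
    (mk⇔ (λ z → proj₂ (to (zeckendorf-∷ 0F w) z)) (λ z → from (zeckendorf-∷ 0F w) ((λ ()) , z)))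
    where open Equivalence

  zeckendorf-recognisable : Recognisable IsZeckendorf
  zeckendorf-recognisable = recognisable-resp
    (λ w → ⇔.trans (partialNFA-accepts ↔-refl _≟ᶠ_ 0F next w) (runs⇔zeckendorf₀ w))
    (determinise zeckendorfNFA)

  ZeckendorfWords : ℕ → Set
  ZeckendorfWords L = ∀ n → n < fib (L + 2) → ∃ λ w → length w ≡ L × ∃ (Run zeckendorfNFA 0F w) × val w ≡ n

  zeckendorf-words-step : ∀ L → ZeckendorfWords (suc L) → ZeckendorfWords L → ZeckendorfWords (suc (suc L))
  zeckendorf-words-step L words₁ words₀ n n< with <-+-split (fib (suc L + 2)) (fib (L + 2)) n n<
  ... | inj₁ n<F =
    let w , lw , (q , r) , vw = words₁ n n<F
    in w ++ 0F ∷ [] , length-++-≡ w _ lw , (0F , run-++ r (next-0 q ∷ [])) , trans (val-++-zeros w 1) vw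
  ... | inj₂ (m , m<F , m+F≡n) =
    let w , lw , (q , r) , vw = words₀ m m<F
    in w ++ 0F ∷ 1F ∷ [] , length-++-≡ w _ lw , (1F , run-++ r (next-0 q ∷ refl ∷ [])) ,
       trans (val-++-0d w 1F)
             (trans (cong₂ _+_ vw (trans (*-identityˡ _) (cong (λ ℓ → fib (suc ℓ + 2)) lw))) m+F≡n)

  zeckendorf-words : ∀ L → ZeckendorfWords L
  zeckendorf-words zero          zero          _ = [] , refl , (0F , []) , refl
  zeckendorf-words zero          (suc _)       (s≤s ())
  zeckendorf-words (suc zero)    zero          _ = 0F ∷ [] , refl , (0F , refl ∷ []) , refl
  zeckendorf-words (suc zero)    (suc zero)    _ = 1F ∷ [] , refl , (1F , refl ∷ []) , refl
  zeckendorf-words (suc zero)    (suc (suc _)) (s≤s (s≤s ()))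
  zeckendorf-words (suc (suc L)) = zeckendorf-words-step L (zeckendorf-words (suc L)) (zeckendorf-words L)

  zeckendorf : NumerationSystem
  zeckendorf = record
    { digits             = 2
    ; Valid              = IsZeckendorf
    ; digit              = inject₁
    ; toℕ-digit          = toℕ-inject₁
    ; valid-recognisable = zeckendorf-recognisable
    ; representation     = λ L n n< → let w , lw , run , vw = zeckendorf-words L n n<
                                      in w , lw , Equivalence.to (runs⇔zeckendorf₀ w) run , vw
    }

open Zeckendorf using (zeckendorf)

module ChungGraham where

  open import Data.Nat using (_+_; _*_; _<_; z≤n; s≤s)
  open import Data.Nat.Properties using (*-suc; +-comm; 0≢1+n; +-identityʳ; *-identityˡ; <-≤-trans)
  open import Data.Nat.Tactic.RingSolver using (solve-∀)
  open import Data.Fin.Properties using (2↔Bool; toℕ-injective)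
  open import Data.Product.Properties using (≡-dec)
  open import Function.Related.TypeIsomorphisms using (→-cong-⇔)

  -- In a state (odd , pending), odd says that the next digit sits at an odd position and pending
  -- that a 2 has been read at an even position since the last 0 at an even position.
  next : Bool × Bool → Fin 3 → Maybe (Bool × Bool)
  next (false , p)     0F      = just (true , false)
  next (false , p)     1F      = just (true , p)
  next (false , false) 2F      = just (true , true)
  next (false , true)  2F      = nothing
  next (true  , p)     0F      = just (false , p)
  next (true  , p)     (suc _) = nothing

  chungGrahamNFA : NFA (Fin 3)
  chungGrahamNFA =
    partialNFA (↔-trans *↔× (2↔Bool ×-↔ 2↔Bool)) (≡-dec Bool._≟_ Bool._≟_) (false , false) next

  pending : Bool → Fin 3 → Bool
  pending p 0F = false
  pending p 1F = p
  pending p 2F = true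

  Allowed : Bool → Fin 3 → Set
  Allowed p 0F = ⊤
  Allowed p 1F = ⊤
  Allowed p 2F = p ≡ false

  next-even⇔ : ∀ p a {q} → next (false , p) a ≡ just q ⇔ (q ≡ (true , pending p a) × Allowed p a)
  next-even⇔ p     0F = mk⇔ (λ { refl → refl , tt }) (λ { (refl , _) → refl })
  next-even⇔ p     1F = mk⇔ (λ { refl → refl , tt }) (λ { (refl , _) → refl })
  next-even⇔ false 2F = mk⇔ (λ { refl → refl , refl }) (λ { (refl , _) → refl })
  next-even⇔ true  2F = mk⇔ (λ ()) (λ { (_ , ()) })

  next-odd⇔ : ∀ p b {q} → next (true , p) b ≡ just q ⇔ (q ≡ (false , p) × b ≡ 0F)
  next-odd⇔ p 0F      = mk⇔ (λ { refl → refl , refl }) (λ { (refl , _) → refl })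
  next-odd⇔ p (suc b) = mk⇔ (λ ()) (λ ())

  Guarded : List (Fin 3) → Set
  Guarded w = ∀ n → dig w (2 * n) ≡ 2 → ∃ λ m → m < n × dig w (2 * m) ≡ 0

  After : Fin 3 → Set → Set
  After 0F G = ⊤
  After 1F G = G
  After 2F G = ⊥

  dig-even : ∀ (a b : Fin 3) r m → dig (a ∷ b ∷ r) (2 * suc m) ≡ dig r (2 * m)
  dig-even a b r m = cong (dig (a ∷ b ∷ r)) (*-suc 2 m)

  dig-odd : ∀ (a b : Fin 3) r m → dig (a ∷ b ∷ r) (2 * suc m + 1) ≡ dig r (2 * m + 1)
  dig-odd a b r m = cong (λ i → dig (a ∷ b ∷ r) (i + 1)) (*-suc 2 m)

  chungGraham-∷∷ : ∀ a b r →
    IsChungGraham (a ∷ b ∷ r) ⇔ (toℕ b ≡ 0 × IsChungGraham r × (toℕ a ≡ 2 → Guarded r))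
  chungGraham-∷∷ a b r = mk⇔ forward backward
    where
    shift : ∀ m → dig (a ∷ b ∷ r) (2 * suc m) ≡ dig r (2 * m)
    shift = dig-even a b r
    forward : IsChungGraham (a ∷ b ∷ r) → toℕ b ≡ 0 × IsChungGraham r × (toℕ a ≡ 2 → Guarded r)
    forward (odd , separated) = odd 0 , (odd′ , separated′) , guarded
      where
      odd′ : ∀ m → dig r (2 * m + 1) ≡ 0
      odd′ m = trans (sym (dig-odd a b r m)) (odd (suc m))
      separated′ : ∀ m n → m < n → dig r (2 * m) ≡ 2 → dig r (2 * n) ≡ 2 →
        ∃ λ p → m < p × p < n × dig r (2 * p) ≡ 0
      separated′ m n m<n d₁ d₂ with separated (suc m) (suc n) (s≤s m<n) (trans (shift m) d₁) (trans (shift n) d₂)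
      ... | zero  , () , _
      ... | suc p , s≤s m<p , s≤s p<n , dp = p , m<p , p<n , trans (sym (shift p)) dp
      guarded : toℕ a ≡ 2 → Guarded r
      guarded a≡2 n d with separated 0 (suc n) (s≤s z≤n) a≡2 (trans (shift n) d)
      ... | zero  , () , _
      ... | suc p , _ , s≤s p<n , dp = p , p<n , trans (sym (shift p)) dp
    backward : toℕ b ≡ 0 × IsChungGraham r × (toℕ a ≡ 2 → Guarded r) → IsChungGraham (a ∷ b ∷ r)
    backward (b≡0 , (odd′ , separated′) , guarded) = odd , separated
      where
      odd : ∀ m → dig (a ∷ b ∷ r) (2 * m + 1) ≡ 0
      odd zero    = b≡0
      odd (suc m) = trans (dig-odd a b r m) (odd′ m)
      separated : ∀ m n → m < n → dig (a ∷ b ∷ r) (2 * m) ≡ 2 → dig (a ∷ b ∷ r) (2 * n) ≡ 2 →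
        ∃ λ p → m < p × p < n × dig (a ∷ b ∷ r) (2 * p) ≡ 0
      separated zero (suc n) _ a≡2 d with guarded a≡2 n (trans (sym (shift n)) d)
      ... | p , p<n , dp = suc p , s≤s z≤n , s≤s p<n , trans (shift p) dp
      separated (suc m) (suc n) (s≤s m<n) d₁ d₂
        with separated′ m n m<n (trans (sym (shift m)) d₁) (trans (sym (shift n)) d₂)
      ... | p , m<p , p<n , dp = suc p , s≤s m<p , s≤s p<n , trans (shift p) dp

  guarded-∷∷ : ∀ a b r → Guarded (a ∷ b ∷ r) ⇔ After a (Guarded r)
  guarded-∷∷ 0F b r = mk⇔ (λ _ → tt) (λ _ → λ { zero () ; (suc n) _ → 0 , s≤s z≤n , refl })
  guarded-∷∷ 1F b r = mk⇔ forward backward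
    where
    shift : ∀ m → dig (1F ∷ b ∷ r) (2 * suc m) ≡ dig r (2 * m)
    shift = dig-even 1F b r
    forward : Guarded (1F ∷ b ∷ r) → Guarded r
    forward g n d with g (suc n) (trans (shift n) d)
    ... | suc p , s≤s p<n , dp = p , p<n , trans (sym (shift p)) dp
    backward : Guarded r → Guarded (1F ∷ b ∷ r)
    backward g (suc n) d with g n (trans (sym (shift n)) d)
    ... | p , p<n , dp = suc p , s≤s p<n , trans (shift p) dp
  guarded-∷∷ 2F b r = mk⇔ (λ g → case g 0 refl of λ { (_ , () , _) }) (λ ())

  dig-single-even : ∀ (a : Fin 3) n → dig (a ∷ []) (2 * suc n) ≡ 0
  dig-single-even a n = cong (dig (a ∷ [])) (*-suc 2 n)

  chungGraham-∷ : ∀ a → IsChungGraham (a ∷ [])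
  chungGraham-∷ a = (λ m → cong (dig (a ∷ [])) (+-comm (2 * m) 1)) ,
                    λ { _ (suc n) _ _ d → ⊥-elim (0≢1+n (trans (sym (dig-single-even a n)) d)) }

  guarded-∷ : ∀ a → (toℕ a ≡ 2 → ⊥) → Guarded (a ∷ [])
  guarded-∷ a a≢2 zero    d = ⊥-elim (a≢2 d)
  guarded-∷ a a≢2 (suc n) d = ⊥-elim (0≢1+n (trans (sym (dig-single-even a n)) d))

  Admissible : Bool → List (Fin 3) → Set
  Admissible p w = IsChungGraham w × (p ≡ true → Guarded w)

  admissible-[] : ∀ p → Admissible p []
  admissible-[] p = ((λ _ → refl) , (λ _ _ _ ())) , (λ _ _ ())

  admissible-∷ : ∀ p a → Admissible p (a ∷ []) ⇔ Allowed p a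
  admissible-∷ p 0F = mk⇔ (λ _ → tt) (λ _ → chungGraham-∷ 0F , λ _ → guarded-∷ 0F (λ ()))
  admissible-∷ p 1F = mk⇔ (λ _ → tt) (λ _ → chungGraham-∷ 1F , λ _ → guarded-∷ 1F (λ ()))
  admissible-∷ false 2F = mk⇔ (λ _ → refl) (λ _ → chungGraham-∷ 2F , λ ())
  admissible-∷ true  2F = mk⇔ (λ (_ , g) → case g refl 0 refl of λ { (_ , () , _) }) (λ ())

  admissible-∷∷ : ∀ p a b r → Admissible p (a ∷ b ∷ r) ⇔ (Allowed p a × toℕ b ≡ 0 × Admissible (pending p a) r)
  admissible-∷∷ p a b r = ⇔.trans (chungGraham-∷∷ a b r ×-⇔ →-cong-⇔ ⇔.refl (guarded-∷∷ a b r)) (regroup p a)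
    where
    regroup : ∀ p a {B C G : Set} →
      ((B × C × (toℕ a ≡ 2 → G)) × (p ≡ true → After a G)) ⇔ (Allowed p a × B × C × (pending p a ≡ true → G))
    regroup p     0F = mk⇔ (λ ((b , c , _) , _) → tt , b , c , λ ()) (λ (_ , b , c , _) → (b , c , λ ()) , _)
    regroup p     1F = mk⇔ (λ ((b , c , _) , g) → tt , b , c , g) (λ (_ , b , c , g) → (b , c , λ ()) , g)
    regroup false 2F = mk⇔ (λ ((b , c , g) , _) → refl , b , c , λ _ → g refl)
                           (λ (_ , b , c , g) → (b , c , λ _ → g refl) , λ ())
    regroup true  2F = mk⇔ (λ (_ , g) → ⊥-elim (g refl)) (λ ())

  runs⇔admissible : ∀ p w → ∃ (Run chungGrahamNFA (false , p) w) ⇔ Admissible p w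
  runs⇔admissible p []          = mk⇔ (λ _ → admissible-[] p) (λ _ → _ , [])
  runs⇔admissible p (a ∷ [])    = mk⇔
    (λ { (_ , s ∷ []) → from (admissible-∷ p a) (proj₂ (to (next-even⇔ p a) s)) })
    (λ adm → _ , from (next-even⇔ p a) (refl , to (admissible-∷ p a) adm) ∷ [])
    where open Equivalence
  runs⇔admissible p (a ∷ b ∷ r) = mk⇔ forward backward
    where
    open Equivalence
    forward : ∃ (Run chungGrahamNFA (false , p) (a ∷ b ∷ r)) → Admissible p (a ∷ b ∷ r)
    forward (q , s₁ ∷ s₂ ∷ run) with to (next-even⇔ p a) s₁
    ... | refl , allowed with to (next-odd⇔ (pending p a) b) s₂
    ... | refl , refl =
      from (admissible-∷∷ p a 0F r) (allowed , refl , to (runs⇔admissible (pending p a) r) (q , run))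
    backward : Admissible p (a ∷ b ∷ r) → ∃ (Run chungGrahamNFA (false , p) (a ∷ b ∷ r))
    backward adm =
      let allowed , b≡0 , adm′ = to (admissible-∷∷ p a b r) adm
          q , run = from (runs⇔admissible (pending p a) r) adm′
      in q , from (next-even⇔ p a) (refl , allowed) ∷ from (next-odd⇔ (pending p a) b) (refl , toℕ-injective b≡0)
             ∷ run

  runs⇔chungGraham : ∀ w → ∃ (Run chungGrahamNFA (false , false) w) ⇔ IsChungGraham w
  runs⇔chungGraham w = ⇔.trans (runs⇔admissible false w) (mk⇔ proj₁ (λ cg → cg , λ ()))

  chungGraham-recognisable : Recognisable IsChungGraham
  chungGraham-recognisable = recognisable-resp
    (λ w → ⇔.trans (partialNFA-accepts _ _ _ next w) (runs⇔chungGraham w))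
    (determinise chungGrahamNFA)

  Word : ℕ → Bool → ℕ → Set
  Word ℓ p n = ∃ λ w → length w ≡ ℓ × Run chungGrahamNFA (false , false) w (true , p) × val w ≡ n

  append : ∀ {ℓ p m n} c → Allowed p c → Word ℓ p m → m + toℕ c * fib (suc ℓ + 2) ≡ n →
    Word (2 + ℓ) (pending p c) n
  append {p = p} c allowed (w , lw , run , vw) m+c*F≡n =
    w ++ 0F ∷ c ∷ [] , length-++-≡ w _ lw ,
    run-++ run (refl ∷ Equivalence.from (next-even⇔ p c) (refl , allowed) ∷ []) ,
    trans (val-++-0d w c) (trans (cong₂ (λ x ℓ → x + toℕ c * fib (suc ℓ + 2)) vw lw) m+c*F≡n)

  Words UnpendingWords : ℕ → Set
  Words ℓ = ∀ n → n < fib (suc ℓ + 2) → ∃ λ p → Word ℓ p n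
  UnpendingWords ℓ = ∀ n → n < fib (ℓ + 2) → Word ℓ false n

  -- Greedy digits, two positions at a time: F (ℓ+5) = 2 F (ℓ+3) + F (ℓ+2), and a final 2 is only needed
  -- for a remainder below F (ℓ+2), which has a representation without a pending 2.
  words-step : ∀ ℓ → Words ℓ → UnpendingWords ℓ → Words (2 + ℓ) × UnpendingWords (2 + ℓ)
  words-step ℓ words unpending = words′ , unpending′
    where
    W T : ℕ
    W = fib (suc ℓ + 2)
    T = fib (ℓ + 2)
    words′ : Words (2 + ℓ)
    words′ n n< with <-+-split W (W + T) n (subst (n <_) (+-comm (W + T) W) n<)
    ... | inj₁ n<W =
      let p , word = words n n<W in _ , append 0F tt word (+-identityʳ n)
    ... | inj₂ (m₁ , m₁< , m₁+W≡n) with <-+-split W T m₁ m₁<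
    ...   | inj₁ m₁<W =
      let p , word = words m₁ m₁<W in _ , append 1F tt word (trans (cong (m₁ +_) (*-identityˡ W)) m₁+W≡n)
    ...   | inj₂ (m₂ , m₂<T , m₂+W≡m₁) =
      _ , append 2F refl (unpending m₂ m₂<T) (trans (twice m₂ W) (trans (cong (_+ W) m₂+W≡m₁) m₁+W≡n))
      where
      twice : ∀ m w → m + 2 * w ≡ m + w + w
      twice = solve-∀
    unpending′ : UnpendingWords (2 + ℓ)
    unpending′ n n< with <-+-split W T n n<
    ... | inj₁ n<W = let p , word = words n n<W in append 0F tt word (+-identityʳ n)
    ... | inj₂ (m , m<T , m+W≡n) =
      append 1F tt (unpending m m<T) (trans (cong (m +_) (*-identityˡ W)) m+W≡n)

  oddLength : ℕ → ℕ
  oddLength zero    = 1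
  oddLength (suc j) = 2 + oddLength j

  odd-words : ∀ j → Words (oddLength j) × UnpendingWords (oddLength j)
  odd-words zero    = words₁ , unpending₁
    where
    words₁ : Words 1
    words₁ 0 _ = _ , 0F ∷ [] , refl , refl ∷ [] , refl
    words₁ 1 _ = _ , 1F ∷ [] , refl , refl ∷ [] , refl
    words₁ 2 _ = _ , 2F ∷ [] , refl , refl ∷ [] , refl
    words₁ (suc (suc (suc _))) (s≤s (s≤s (s≤s ())))
    unpending₁ : UnpendingWords 1
    unpending₁ 0 _ = 0F ∷ [] , refl , refl ∷ [] , refl
    unpending₁ 1 _ = 1F ∷ [] , refl , refl ∷ [] , refl
    unpending₁ (suc (suc _)) (s≤s (s≤s ()))
  odd-words (suc j) = let words , unpending = odd-words j in words-step (oddLength j) words unpending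

  data LengthView : ℕ → Set where
    empty : LengthView 0
    odd   : ∀ j → LengthView (oddLength j)
    even  : ∀ j → LengthView (suc (oddLength j))

  lengthView : ∀ L → LengthView L
  lengthView zero = empty
  lengthView (suc L) with lengthView L
  ... | empty  = odd 0
  ... | odd j  = even j
  ... | even j = odd (suc j)

  chungGraham-words : ∀ L n → n < fib (L + 2) →
    ∃ λ w → length w ≡ L × ∃ (Run chungGrahamNFA (false , false) w) × val w ≡ n
  chungGraham-words L n n< with lengthView L
  chungGraham-words _ zero    _        | empty = [] , refl , (_ , []) , refl
  chungGraham-words _ (suc n) (s≤s ()) | empty
  ... | odd j =
    let _ , w , lw , run , vw = proj₁ (odd-words j) n (<-≤-trans n< (fib-≤-suc (oddLength j + 2)))
    in w , lw , (_ , run) , vw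
  ... | even j =
    let _ , w , lw , run , vw = proj₁ (odd-words j) n n<
    in w ++ 0F ∷ [] , length-++-≡ w _ lw , (_ , run-++ run (refl ∷ [])) , trans (val-++-zeros w 1) vw

  chungGraham : NumerationSystem
  chungGraham = record
    { digits             = 3
    ; Valid              = IsChungGraham
    ; digit              = λ d → d
    ; toℕ-digit          = λ _ → refl
    ; valid-recognisable = chungGraham-recognisable
    ; representation     = λ L n n< → let w , lw , run , vw = chungGraham-words L n n<
                                      in w , lw , Equivalence.to (runs⇔chungGraham w) run , vw
    }

open ChungGraham using (chungGraham)

mainTheorem4 : (f : ℕ → ℕ) → FibonacciSynchronised f ⇔ ChungGrahamSynchronised f
mainTheorem4 f = ⇔.trans (synchronised⇔graph zeckendorf f) (⇔.sym (synchronised⇔graph chungGraham f))
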